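{- The hypercube $Q_7$ has an $L_{16}$-decomposition.
   Context: The hypercube $Q_7$ is the graph whose vertices are the binary strings of length $7$, two vertices being adjacent if and only if they differ in exactly one position. The sunlet graph $L_{16}$ is the graph obtained from a cycle of length $8$ by attaching one pendant edge (to a new vertex) at each vertex of the cycle. For a graph $H$, an $H$-decomposition of a graph $G$ is a collection of edge-disjoint subgraphs of $G$, each isomorphic to $H$, whose edge sets partition $E(G)$. -}

module Defs where

open import Data.Nat using (ℕ; suc; NonZero)
open import Data.Nat.DivMod using (_mod_)
open import Data.Fin using (Fin; toℕ)
open import Data.Bool using (Bool)
open import Data.Vec using (Vec; lookup)
open import Data.Sum using (_⊎_; inj₁; inj₂)
open import Data.Product using (Σ; ∃; ∃!; _×_; _,_)
open import Relation.Binary.PropositionalEquality using (_≡_)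
open import Relation.Nullary using (¬_)
open import Function.Definitions using (Injective)

QVertex : ℕ → Set
QVertex n = Vec Bool n

QAdj : (n : ℕ) → QVertex n → QVertex n → Set
QAdj n u v = Σ (Fin n) λ i →
  (¬ (lookup u i ≡ lookup v i)) × ((j : Fin n) → ¬ (j ≡ i) → lookup u j ≡ lookup v j)

SamePair : {A : Set} → A → A → A → A → Set
SamePair a b c d = ((a ≡ c) × (b ≡ d)) ⊎ ((a ≡ d) × (b ≡ c))

-- The sunlet graph L_{2m}: a cycle of length m (vertices inj₁ i) with a
-- pendant vertex inj₂ i attached to each cycle vertex inj₁ i.

SVertex : ℕ → Set
SVertex m = Fin m ⊎ Fin m

next : (m : ℕ) .{{_ : NonZero m}} → Fin m → Fin m
next m i = suc (toℕ i) mod m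

data SEdge (m : ℕ) : Set where
  cyc  : Fin m → SEdge m
  pend : Fin m → SEdge m

ends₁ ends₂ : (m : ℕ) .{{_ : NonZero m}} → SEdge m → SVertex m
ends₁ m (cyc i)  = inj₁ i
ends₁ m (pend i) = inj₁ i
ends₂ m (cyc i)  = inj₁ (next m i)
ends₂ m (pend i) = inj₂ i

-- A subgraph of Q_n isomorphic to the sunlet L_{2m}: given by an
-- injective map of the sunlet's vertices into Q_n sending each sunlet
-- edge to an edge of Q_n (its edge set is the image of the sunlet edges).

record SunletCopy (n m : ℕ) .{{_ : NonZero m}} : Set where
  field
    f     : SVertex m → QVertex n
    inj   : Injective _≡_ _≡_ f
    edges : (e : SEdge m) → QAdj n (f (ends₁ m e)) (f (ends₂ m e))

open SunletCopy public

Covers : {n m : ℕ} .{{_ : NonZero m}} → SunletCopy n m → SEdge m →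
         QVertex n → QVertex n → Set
Covers {n} {m} c e u v = SamePair (f c (ends₁ m e)) (f c (ends₂ m e)) u v

-- Each copy's edge set has exactly 2m edges, so "exactly one
-- (copy, sunlet edge) pair" is the same as partitioning E(Q_n).
SunletDecomposition : (n m : ℕ) .{{_ : NonZero m}} → Set
SunletDecomposition n m =
  Σ ℕ λ t → Σ (Fin t → SunletCopy n m) λ copies →
    (u v : QVertex n) → QAdj n u v →
      ∃! _≡_ λ (p : Fin t × SEdge m) → let (k , e) = p in Covers (copies k) e u v

module Submission where

-- The 448 edges of Q₇ are split among 28 sunlets in seven orbits of four. Each orbit
-- consists of a base sunlet, given by a closed walk of length 8 in Q₇ (its cycle) and a
-- pendant direction at every cycle vertex, together with its translates by a
-- two-dimensional group of translations u ↦ u ⊕ w, which are automorphisms of Q₇.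
-- Assign to every edge of Q₇ the first sunlet edge that covers it: a finite computation
-- shows that this assignment is defined everywhere and is inverse to the map sending a
-- sunlet edge to the edge of Q₇ it occupies, so every edge is covered exactly once.

open import Data.Bool using (Bool; true; false; not; _xor_)
open import Data.Bool.Properties using (not-¬; ¬-not; xor-assoc; xor-same; xor-identityʳ)
  renaming (_≟_ to _≟ᵇ_)
open import Data.Fin using (Fin; zero; suc; toℕ; inject₁; fromℕ; #_) renaming (_≟_ to _≟ᶠ_)
open import Data.Fin.Properties using (all?; toℕ-injective; toℕ-inject₁; toℕ-fromℕ; toℕ-fromℕ<; toℕ<n)
open import Data.List as List using (List; allFin; cartesianProduct; find; _++_)
open import Data.Maybe using (fromMaybe)
open import Data.Nat using (ℕ; zero; suc; NonZero; _%_)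
open import Data.Nat.DivMod using (m%n<n; m<n⇒m%n≡m; n%n≡0)
open import Data.Nat.Properties using (m≤n⇒m<n∨m≡n)
open import Data.Product using (∃; ∃!; _×_; _,_; proj₁; proj₂)
open import Data.Product.Properties using () renaming (≡-dec to ×-≡-dec)
open import Data.Sum using (_⊎_; inj₁; inj₂)
open import Data.Sum.Properties using () renaming (≡-dec to ⊎-≡-dec)
open import Data.Vec as Vec using (Vec; []; _∷_; lookup; zipWith; replicate; concat; _[_]%=_; _[_]≔_)
open import Data.Vec.Properties using (lookup∘updateAt; lookup∘updateAt′; []%=-∘; lookup-zipWith)
  renaming (≡-dec to Vec-≡-dec)
open import Data.Vec.Relation.Binary.Pointwise.Extensional using (ext; Pointwise-≡⇒≡)
open import Function using (_∘_)
open import Relation.Binary.Definitions using (DecidableEquality)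
open import Relation.Binary.PropositionalEquality
open import Relation.Nullary using (Dec; yes; no; contradiction)
open import Relation.Nullary.Decidable using (from-yes; map′; _×-dec_; _⊎-dec_; _→-dec_)

open import Defs

private
  variable
    n m t : ℕ

flip : QVertex n → Fin n → QVertex n
flip u i = u [ i ]%= not

lookup-flip : (u : QVertex n) (i : Fin n) → lookup (flip u i) i ≡ not (lookup u i)
lookup-flip u i = lookup∘updateAt i u

lookup-flip-≢ : (u : QVertex n) {i j : Fin n} → j ≢ i → lookup (flip u i) j ≡ lookup u j
lookup-flip-≢ u {i} {j} j≢i = lookup∘updateAt′ j i j≢i u

-- The direction i is returned without matching on the equation, so the direction of an
-- edge built this way computes even when the equation is a stuck proof.
≡flip⇒adjacent : (u : QVertex n) {v : QVertex n} (i : Fin n) → v ≡ flip u i → QAdj n u v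
≡flip⇒adjacent u {v} i v≡ = i , differ , agree
  where
  at : ∀ j → lookup v j ≡ lookup (flip u i) j
  at j = cong (λ w → lookup w j) v≡

  differ : lookup u i ≢ lookup v i
  differ eq = not-¬ refl (trans eq (trans (at i) (lookup-flip u i)))

  agree : ∀ j → j ≢ i → lookup u j ≡ lookup v j
  agree j j≢i = trans (sym (lookup-flip-≢ u j≢i)) (sym (at j))

adjacent⇒≡flip : {u v : QVertex n} → QAdj n u v → ∃ λ i → v ≡ flip u i
adjacent⇒≡flip {u = u} {v} (i , differ , agree) = i , Pointwise-≡⇒≡ (ext at)
  where
  at : ∀ j → lookup v j ≡ lookup (flip u i) j
  at j with j ≟ᶠ i
  ... | yes refl = trans (¬-not (differ ∘ sym)) (sym (lookup-flip u i))
  ... | no j≢i   = trans (sym (agree j j≢i)) (sym (lookup-flip-≢ u j≢i))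

flip-injective : (u : QVertex n) {i j : Fin n} → flip u i ≡ flip u j → i ≡ j
flip-injective u {i} {j} eq with i ≟ᶠ j
... | yes i≡j = i≡j
... | no i≢j  = contradiction (begin
  lookup u i           ≡⟨ lookup-flip-≢ u i≢j ⟨
  lookup (flip u j) i  ≡⟨ cong (λ w → lookup w i) eq ⟨
  lookup (flip u i) i  ≡⟨ lookup-flip u i ⟩
  not (lookup u i)     ∎) (not-¬ refl)
  where open ≡-Reasoning

flip∘flip≡id⇒≡ : (u : QVertex n) {i j : Fin n} → flip (flip u i) j ≡ u → i ≡ j
flip∘flip≡id⇒≡ u {i} {j} eq with i ≟ᶠ j
... | yes i≡j = i≡j
... | no i≢j  = contradiction (begin
  lookup u i                    ≡⟨ cong (λ w → lookup w i) eq ⟨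
  lookup (flip (flip u i) j) i  ≡⟨ lookup-flip-≢ (flip u i) i≢j ⟩
  lookup (flip u i) i           ≡⟨ lookup-flip u i ⟩
  not (lookup u i)              ∎) (not-¬ refl)
  where open ≡-Reasoning

samePair-flip : {a u : QVertex n} {i j : Fin n} → SamePair a (flip a j) u (flip u i) →
                j ≡ i × (a ≡ u ⊎ a ≡ flip u i)
samePair-flip {u = u} (inj₁ (refl , eq)) = flip-injective u eq , inj₁ refl
samePair-flip {u = u} (inj₂ (refl , eq)) = sym (flip∘flip≡id⇒≡ u eq) , inj₂ refl

flip-[]≔ : (u : QVertex n) (i : Fin n) (x : Bool) → flip u i [ i ]≔ x ≡ u [ i ]≔ x
flip-[]≔ u i x = []%=-∘ u i

_⊕_ : QVertex n → QVertex n → QVertex n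
_⊕_ = zipWith _xor_

xor-injectiveˡ : (z : Bool) {x y : Bool} → x xor z ≡ y xor z → x ≡ y
xor-injectiveˡ z {x} {y} eq = begin
  x                ≡⟨ cancel x ⟨
  (x xor z) xor z  ≡⟨ cong (_xor z) eq ⟩
  (y xor z) xor z  ≡⟨ cancel y ⟩
  y                ∎
  where
  open ≡-Reasoning
  cancel : ∀ w → (w xor z) xor z ≡ w
  cancel w = trans (xor-assoc w z z) (trans (cong (w xor_) (xor-same z)) (xor-identityʳ w))

lookup-⊕ : (u w : QVertex n) (j : Fin n) → lookup (u ⊕ w) j ≡ lookup u j xor lookup w j
lookup-⊕ u w j = lookup-zipWith _xor_ j u w

lookup-⊕-injectiveˡ : (w : QVertex n) {u v : QVertex n} (j : Fin n) →
                      lookup (u ⊕ w) j ≡ lookup (v ⊕ w) j → lookup u j ≡ lookup v j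
lookup-⊕-injectiveˡ w {u} {v} j eq =
  xor-injectiveˡ (lookup w j) (trans (sym (lookup-⊕ u w j)) (trans eq (lookup-⊕ v w j)))

⊕-injectiveˡ : (w : QVertex n) {u v : QVertex n} → u ⊕ w ≡ v ⊕ w → u ≡ v
⊕-injectiveˡ w {u} {v} eq =
  Pointwise-≡⇒≡ (ext λ j → lookup-⊕-injectiveˡ w {u} {v} j (cong (λ x → lookup x j) eq))

⊕-adjacent : (w u v : QVertex n) → QAdj n u v → QAdj n (u ⊕ w) (v ⊕ w)
⊕-adjacent w u v (i , differ , agree) = i , differ ∘ lookup-⊕-injectiveˡ w {u} {v} i , λ j j≢i → begin
  lookup (u ⊕ w) j           ≡⟨ lookup-⊕ u w j ⟩
  lookup u j xor lookup w j  ≡⟨ cong (_xor lookup w j) (agree j j≢i) ⟩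
  lookup v j xor lookup w j  ≡⟨ lookup-⊕ v w j ⟨
  lookup (v ⊕ w) j           ∎
  where open ≡-Reasoning

translate : .{{_ : NonZero m}} → QVertex n → SunletCopy n m → SunletCopy n m
translate {m = m} w c = record
  { f     = λ x → f c x ⊕ w
  ; inj   = inj c ∘ ⊕-injectiveˡ w
  ; edges = λ e → ⊕-adjacent w (f c (ends₁ m e)) (f c (ends₂ m e)) (edges c e)
  }

walk : QVertex n → Vec (Fin n) m → Fin (suc m) → QVertex n
walk u ds       zero    = u
walk u (d ∷ ds) (suc j) = walk (flip u d) ds j

ClosedWalk : QVertex n → Vec (Fin n) m → Set
ClosedWalk {m = m} u ds = walk u ds (fromℕ m) ≡ u

walk-step : (u : QVertex n) (ds : Vec (Fin n) m) (i : Fin m) →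
            walk u ds (suc i) ≡ flip (walk u ds (inject₁ i)) (lookup ds i)
walk-step u (d ∷ ds) zero    = refl
walk-step u (d ∷ ds) (suc i) = walk-step (flip u d) ds i

toℕ-next : .{{_ : NonZero m}} (i : Fin m) → toℕ (next m i) ≡ suc (toℕ i) % m
toℕ-next {m = m} i = toℕ-fromℕ< (m%n<n (suc (toℕ i)) m)

inject₁-next : .{{_ : NonZero m}} (i : Fin m) →
               inject₁ (next m i) ≡ suc i ⊎ (inject₁ (next m i) ≡ zero × suc i ≡ fromℕ m)
inject₁-next {m = m} i with m≤n⇒m<n∨m≡n (toℕ<n i)
... | inj₁ 1+i<m = inj₁ (toℕ-injective (begin
  toℕ (inject₁ (next m i))  ≡⟨ toℕ-inject₁ (next m i) ⟩
  toℕ (next m i)            ≡⟨ toℕ-next i ⟩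
  suc (toℕ i) % m           ≡⟨ m<n⇒m%n≡m 1+i<m ⟩
  suc (toℕ i)               ∎))
  where open ≡-Reasoning
... | inj₂ 1+i≡m = inj₂ (toℕ-injective (begin
  toℕ (inject₁ (next m i))  ≡⟨ toℕ-inject₁ (next m i) ⟩
  toℕ (next m i)            ≡⟨ toℕ-next i ⟩
  suc (toℕ i) % m           ≡⟨ cong (_% m) 1+i≡m ⟩
  m % m                     ≡⟨ n%n≡0 m ⟩
  0                         ∎) , toℕ-injective (trans 1+i≡m (sym (toℕ-fromℕ m))))
  where open ≡-Reasoning

closedWalk-step : .{{_ : NonZero m}} (u : QVertex n) (ds : Vec (Fin n) m) → ClosedWalk u ds →
                  (i : Fin m) → walk u ds (inject₁ (next m i)) ≡ flip (walk u ds (inject₁ i)) (lookup ds i)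
closedWalk-step u ds closed i with inject₁-next i
... | inj₁ eq = trans (cong (walk u ds) eq) (walk-step u ds i)
... | inj₂ (eq₀ , eqₘ) = begin
  walk u ds (inject₁ (next _ i))              ≡⟨ cong (walk u ds) eq₀ ⟩
  u                                           ≡⟨ closed ⟨
  walk u ds (fromℕ _)                         ≡⟨ cong (walk u ds) eqₘ ⟨
  walk u ds (suc i)                           ≡⟨ walk-step u ds i ⟩
  flip (walk u ds (inject₁ i)) (lookup ds i)  ∎
  where open ≡-Reasoning

module _ .{{_ : NonZero m}} (s : QVertex n) (cs ps : Vec (Fin n) m) where

  walkSunletMap : SVertex m → QVertex n
  walkSunletMap (inj₁ i) = walk s cs (inject₁ i)
  walkSunletMap (inj₂ i) = flip (walk s cs (inject₁ i)) (lookup ps i)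

  walkSunletMap-adjacent : ClosedWalk s cs → (e : SEdge m) →
                           QAdj n (walkSunletMap (ends₁ m e)) (walkSunletMap (ends₂ m e))
  walkSunletMap-adjacent closed (cyc i)  =
    ≡flip⇒adjacent (walk s cs (inject₁ i)) (lookup cs i) (closedWalk-step s cs closed i)
  walkSunletMap-adjacent closed (pend i) =
    ≡flip⇒adjacent (walk s cs (inject₁ i)) (lookup ps i) refl

  walkSunlet : ClosedWalk s cs → (∀ x y → walkSunletMap x ≡ walkSunletMap y → x ≡ y) →
               SunletCopy n m
  walkSunlet closed injective = record
    { f = walkSunletMap ; inj = injective _ _ ; edges = walkSunletMap-adjacent closed }

_≟ᵛ_ : DecidableEquality (QVertex n)
_≟ᵛ_ = Vec-≡-dec _≟ᵇ_

_≟ᵉ_ : DecidableEquality (SEdge m)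
cyc i  ≟ᵉ cyc j  = map′ (cong cyc) (λ { refl → refl }) (i ≟ᶠ j)
cyc _  ≟ᵉ pend _ = no λ ()
pend _ ≟ᵉ cyc _  = no λ ()
pend i ≟ᵉ pend j = map′ (cong pend) (λ { refl → refl }) (i ≟ᶠ j)

∀-QVertex? : {P : QVertex n → Set} → (∀ u → Dec (P u)) → Dec (∀ u → P u)
∀-QVertex? {n = zero}  P? = map′ (λ { p [] → p }) (λ p → p []) (P? [])
∀-QVertex? {n = suc n} P? = map′ (λ { (p , q) (true ∷ u) → p u ; (p , q) (false ∷ u) → q u })
  (λ p → p ∘ (true ∷_) , p ∘ (false ∷_))
  (∀-QVertex? (P? ∘ (true ∷_)) ×-dec ∀-QVertex? (P? ∘ (false ∷_)))

∀-SVertex? : {P : SVertex m → Set} → (∀ x → Dec (P x)) → Dec (∀ x → P x)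
∀-SVertex? P? = map′ (λ { (p , q) (inj₁ i) → p i ; (p , q) (inj₂ i) → q i })
  (λ p → p ∘ inj₁ , p ∘ inj₂) (all? (P? ∘ inj₁) ×-dec all? (P? ∘ inj₂))

∀-SEdge? : {P : SEdge m → Set} → (∀ e → Dec (P e)) → Dec (∀ e → P e)
∀-SEdge? P? = map′ (λ { (p , q) (cyc i) → p i ; (p , q) (pend i) → q i })
  (λ p → p ∘ cyc , p ∘ pend) (all? (P? ∘ cyc) ×-dec all? (P? ∘ pend))

injective? : (φ : SVertex m → QVertex n) → Dec (∀ x y → φ x ≡ φ y → x ≡ y)
injective? φ = ∀-SVertex? λ x → ∀-SVertex? λ y → φ x ≟ᵛ φ y →-dec ⊎-≡-dec _≟ᶠ_ _≟ᶠ_ x y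

samePair? : (a b u v : QVertex n) → Dec (SamePair a b u v)
samePair? a b u v = (a ≟ᵛ u ×-dec b ≟ᵛ v) ⊎-dec (a ≟ᵛ v ×-dec b ≟ᵛ u)

module _ .{{_ : NonZero m}} (copies : Fin t → SunletCopy n m) where

  Piece : Set
  Piece = Fin t × SEdge m

  CoversEdge : Piece → QVertex n → QVertex n → Set
  CoversEdge (k , e) = Covers (copies k) e

  coversEdge? : (p : Piece) (u v : QVertex n) → Dec (CoversEdge p u v)
  coversEdge? (k , e) = samePair? (f (copies k) (ends₁ m e)) (f (copies k) (ends₂ m e))

  tail : Piece → QVertex n
  tail (k , e) = f (copies k) (ends₁ m e)

  direction : Piece → Fin n
  direction (k , e) = proj₁ (edges (copies k) e)

  owner⇒decomposition : (owner : QVertex n → Fin n → Piece) →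
                        (∀ u i → owner (flip u i) i ≡ owner u i) →
                        (∀ u i → CoversEdge (owner u i) u (flip u i)) →
                        (∀ p → owner (tail p) (direction p) ≡ p) →
                        SunletDecomposition n m
  owner⇒decomposition owner stable covers owns = t , copies , coveredOnce
    where
    owner-endpoint : ∀ {a u} i → a ≡ u ⊎ a ≡ flip u i → owner u i ≡ owner a i
    owner-endpoint i (inj₁ refl)         = refl
    owner-endpoint {u = u} i (inj₂ refl) = sym (stable u i)

    owner-unique : ∀ u i p → CoversEdge p u (flip u i) → owner u i ≡ p
    owner-unique u i p@(k , e) c = begin
      owner u i                     ≡⟨ owner-endpoint i (proj₂ j≡i,endpoint) ⟩
      owner (tail p) i              ≡⟨ cong (owner (tail p)) (proj₁ j≡i,endpoint) ⟨
      owner (tail p) (direction p)  ≡⟨ owns p ⟩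
      p                             ∎
      where
      open ≡-Reasoning
      head≡flip = proj₂ (adjacent⇒≡flip {u = tail p} (edges (copies k) e))
      j≡i,endpoint = samePair-flip (subst (λ b → SamePair (tail p) b u (flip u i)) head≡flip c)

    coveredOnce : (u v : QVertex n) → QAdj n u v → ∃! _≡_ λ p → CoversEdge p u v
    coveredOnce u v adj with adjacent⇒≡flip {u = u} {v} adj
    ... | i , refl = owner u i , covers u i , owner-unique u i _

record Orbit : Set where
  field
    start                 : QVertex 7
    cycleWord pendantWord : Vec (Fin 7) 8
    shift₁ shift₂         : QVertex 7

open Orbit

e₀₁ e₂₃ e₄₅ : QVertex 7
e₀₁ = true ∷ true ∷ false ∷ false ∷ false ∷ false ∷ false ∷ []
e₂₃ = false ∷ false ∷ true ∷ true ∷ false ∷ false ∷ false ∷ []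
e₄₅ = false ∷ false ∷ false ∷ false ∷ true ∷ true ∷ false ∷ []

orbits : Vec Orbit 7
orbits =
    record { start = false ∷ true ∷ true ∷ false ∷ true ∷ true ∷ true ∷ []
           ; cycleWord = # 6 ∷ # 3 ∷ # 6 ∷ # 2 ∷ # 6 ∷ # 3 ∷ # 6 ∷ # 2 ∷ []
           ; pendantWord = # 1 ∷ # 4 ∷ # 4 ∷ # 1 ∷ # 1 ∷ # 4 ∷ # 4 ∷ # 1 ∷ []
           ; shift₁ = e₀₁ ; shift₂ = e₄₅ }
  ∷ record { start = false ∷ true ∷ false ∷ false ∷ true ∷ true ∷ true ∷ []
           ; cycleWord = # 4 ∷ # 2 ∷ # 5 ∷ # 3 ∷ # 4 ∷ # 2 ∷ # 5 ∷ # 3 ∷ []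
           ; pendantWord = # 5 ∷ # 6 ∷ # 0 ∷ # 4 ∷ # 5 ∷ # 6 ∷ # 0 ∷ # 4 ∷ []
           ; shift₁ = e₀₁ ; shift₂ = e₂₃ }
  ∷ record { start = false ∷ true ∷ true ∷ false ∷ false ∷ true ∷ true ∷ []
           ; cycleWord = # 6 ∷ # 0 ∷ # 6 ∷ # 1 ∷ # 6 ∷ # 0 ∷ # 6 ∷ # 1 ∷ []
           ; pendantWord = # 3 ∷ # 3 ∷ # 4 ∷ # 4 ∷ # 3 ∷ # 3 ∷ # 4 ∷ # 4 ∷ []
           ; shift₁ = e₂₃ ; shift₂ = e₄₅ }
  ∷ record { start = false ∷ false ∷ true ∷ false ∷ false ∷ true ∷ true ∷ []
           ; cycleWord = # 2 ∷ # 4 ∷ # 2 ∷ # 5 ∷ # 2 ∷ # 4 ∷ # 2 ∷ # 5 ∷ []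
           ; pendantWord = # 3 ∷ # 0 ∷ # 3 ∷ # 0 ∷ # 3 ∷ # 0 ∷ # 3 ∷ # 0 ∷ []
           ; shift₁ = e₀₁ ; shift₂ = e₂₃ }
  ∷ record { start = true ∷ true ∷ true ∷ true ∷ true ∷ true ∷ false ∷ []
           ; cycleWord = # 4 ∷ # 6 ∷ # 5 ∷ # 6 ∷ # 4 ∷ # 6 ∷ # 5 ∷ # 6 ∷ []
           ; pendantWord = # 2 ∷ # 2 ∷ # 1 ∷ # 0 ∷ # 2 ∷ # 2 ∷ # 1 ∷ # 0 ∷ []
           ; shift₁ = e₀₁ ; shift₂ = e₂₃ }
  ∷ record { start = true ∷ true ∷ false ∷ true ∷ false ∷ true ∷ false ∷ []
           ; cycleWord = # 3 ∷ # 0 ∷ # 2 ∷ # 1 ∷ # 3 ∷ # 0 ∷ # 2 ∷ # 1 ∷ []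
           ; pendantWord = # 5 ∷ # 1 ∷ # 5 ∷ # 5 ∷ # 5 ∷ # 1 ∷ # 5 ∷ # 5 ∷ []
           ; shift₁ = e₀₁ ; shift₂ = e₄₅ }
  ∷ record { start = false ∷ false ∷ false ∷ false ∷ true ∷ true ∷ false ∷ []
           ; cycleWord = # 3 ∷ # 1 ∷ # 2 ∷ # 0 ∷ # 3 ∷ # 1 ∷ # 2 ∷ # 0 ∷ []
           ; pendantWord = # 5 ∷ # 6 ∷ # 0 ∷ # 1 ∷ # 5 ∷ # 6 ∷ # 0 ∷ # 1 ∷ []
           ; shift₁ = e₀₁ ; shift₂ = e₄₅ }
  ∷ []


baseMap : Orbit → SVertex 8 → QVertex 7
baseMap o = walkSunletMap (start o) (cycleWord o) (pendantWord o)

base-valid : (g : Fin 7) → let o = lookup orbits g in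
             ClosedWalk (start o) (cycleWord o) × (∀ x y → baseMap o x ≡ baseMap o y → x ≡ y)
base-valid = from-yes (all? λ g → let o = lookup orbits g in
  walk (start o) (cycleWord o) (fromℕ 8) ≟ᵛ start o ×-dec injective? (baseMap o))

orbitCopies : Fin 7 → Vec (SunletCopy 7 8) 4
orbitCopies g = Vec.map (λ w → translate w base) (replicate _ false ∷ a ∷ b ∷ a ⊕ b ∷ [])
  where
  o = lookup orbits g
  base = walkSunlet (start o) (cycleWord o) (pendantWord o) (proj₁ (base-valid g)) (proj₂ (base-valid g))
  a = shift₁ o
  b = shift₂ o

copies : Fin 28 → SunletCopy 7 8
copies = lookup (concat (Vec.map orbitCopies (Vec.allFin 7)))

pieces : List (Piece copies)
pieces = cartesianProduct (allFin 28) (List.map cyc (allFin 8) ++ List.map pend (allFin 8))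

-- The fallback piece is junk: owner-covers checks that the piece returned covers the edge.
firstCovering : QVertex 7 → Fin 7 → Piece copies
firstCovering u i = fromMaybe (zero , cyc zero) (find (λ p → coversEdge? copies p u (flip u i)) pieces)

owner : QVertex 7 → Fin 7 → Piece copies
owner u i = firstCovering (u [ i ]≔ false) i

owner-stable : ∀ u i → owner (flip u i) i ≡ owner u i
owner-stable u i = cong (λ c → firstCovering c i) (flip-[]≔ u i false)

owner-covers : ∀ u i → CoversEdge copies (owner u i) u (flip u i)
owner-covers = from-yes (∀-QVertex? λ u → all? λ i → coversEdge? copies (owner u i) u (flip u i))

owner-owns : ∀ p → owner (tail copies p) (direction copies p) ≡ p
owner-owns (k , e) = from-yes (all? λ k → ∀-SEdge? λ e →
  ×-≡-dec _≟ᶠ_ _≟ᵉ_ (owner (tail copies (k , e)) (direction copies (k , e))) (k , e)) k e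

lemma7 : SunletDecomposition 7 8
lemma7 = owner⇒decomposition copies owner owner-stable owner-covers owner-owns
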